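{- Let $\mathcal P$ be a vertex-faithful regular polyhedron of type $\{p,q\}$ with $v$ vertices. If $\mathcal P$ is orientable, then $q<v$; if $\mathcal P$ is non-orientable, then $q\leq v$.
   Context: An abstract regular polyhedron has flag-transitive automorphism group $\Gamma(\mathcal P)=\langle\rho_0,\rho_1,\rho_2\rangle$ generated by distinguished involutions with respect to a base flag ($\rho_i$ changes only the rank-$i$ face). Type $\{p,q\}$ means $\rho_0\rho_1$ has order $p$ and $\rho_1\rho_2$ has order $q$ (so each vertex lies on $q$ edges). $\mathcal P$ is vertex-faithful if $\Gamma(\mathcal P)$ acts faithfully on its vertices. $\mathcal P$ is orientable if every word in the $\rho_i$ equal to the identity has even length, and non-orientable otherwise. -}

module Defs where

open import Level using (Level; _⊔_)
open import Algebra.Bundles using (Group)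
open import Data.Nat using (ℕ; zero; suc; _<_; _≤_)
open import Data.Nat.Divisibility using (_∣_)
open import Data.Fin using (Fin; zero; suc)
open import Data.Bool using (Bool; T; _∧_)
open import Data.Bool.Base using (true; false)
open import Relation.Binary.PropositionalEquality using (_≡_)
open import Data.List using (List; []; _∷_; length)
open import Data.List.Relation.Unary.All using (All)
open import Data.Product using (Σ; _×_; ∃)
open import Relation.Nullary using (¬_)

-- Everything about an abstract regular polyhedron is expressed through its
-- automorphism group Γ(P) = ⟨ρ₀, ρ₁, ρ₂⟩ (a string C-group of rank 3).
module _ {c ℓ : Level} (G : Group c ℓ) where
  open Group G

  pow : Carrier → ℕ → Carrier
  pow g zero    = ε
  pow g (suc n) = g ∙ pow g n

  HasOrder : Carrier → ℕ → Set ℓ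
  HasOrder g n = (0 < n) × (pow g n ≈ ε) × (∀ k → 0 < k → k < n → ¬ (pow g k ≈ ε))

  IsInvolution : Carrier → Set ℓ
  IsInvolution g = HasOrder g 2

  module Words (ρ : Fin 3 → Carrier) where
    eval : List (Fin 3) → Carrier
    eval []      = ε
    eval (i ∷ w) = ρ i ∙ eval w

    -- g lies in the subgroup ⟨ρᵢ : i ∈ I⟩  (the ρᵢ are involutions, so
    -- positive words suffice)
    InGen : (Fin 3 → Bool) → Carrier → Set ℓ
    InGen I g = Σ (List (Fin 3)) λ w → All (λ i → T (I i)) w × (eval w ≈ g)

  i01 i12 : Fin 3 → Bool
  i01 zero = true
  i01 (suc zero) = true
  i01 (suc (suc zero)) = false
  i12 zero = false
  i12 (suc zero) = true
  i12 (suc (suc zero)) = true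

  record IsRegularPolyhedronGroup (ρ : Fin 3 → Carrier) : Set (c ⊔ ℓ) where
    open Words ρ
    field
      involutions  : ∀ i → IsInvolution (ρ i)
      generates    : ∀ g → InGen (λ _ → true) g
      string       : (ρ zero ∙ ρ (suc (suc zero))) ∙ (ρ zero ∙ ρ (suc (suc zero))) ≈ ε
      intersection : ∀ (I J : Fin 3 → Bool) g →
                     InGen I g → InGen J g → InGen (λ k → I k ∧ J k) g

  module _ (ρ : Fin 3 → Carrier) where
    open Words ρ

    HasType : ℕ → ℕ → Set ℓ
    HasType p q = HasOrder (ρ zero ∙ ρ (suc zero)) p
                × HasOrder (ρ (suc zero) ∙ ρ (suc (suc zero))) q

    -- vertices = left cosets g⟨ρ₁,ρ₂⟩; g and h give the same vertex
    -- iff g⁻¹h ∈ ⟨ρ₁,ρ₂⟩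
    SameVertex : Carrier → Carrier → Set ℓ
    SameVertex g h = InGen i12 (g ⁻¹ ∙ h)

    HasVertices : ℕ → Set (c ⊔ ℓ)
    HasVertices v = Σ (Fin v → Carrier) λ r →
        (∀ i j → SameVertex (r i) (r j) → i ≡ j)
      × (∀ g → ∃ λ i → SameVertex (r i) g)

    VertexFaithful : Set (c ⊔ ℓ)
    VertexFaithful = ∀ g → (∀ h → SameVertex (g ∙ h) h) → g ≈ ε

    Orientable : Set ℓ
    Orientable = ∀ w → eval w ≈ ε → 2 ∣ length w

-- Let Γ₀ = ⟨ρ₁,ρ₂⟩ be the stabiliser of the base vertex and σ = ρ₁ρ₂, of order q. The
-- base vertex has the q neighbours σʲρ₀Γ₀; they are distinct unless some σᵗ with
-- 0 < t < q fixes ρ₀Γ₀, and otherwise together with Γ₀ they give q < v. For the least such t, ρ₀σᵗρ₀ ∈ Γ₀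
-- is a rotation σⁱ or a reflection σⁱρ₂. A rotation makes ⟨σᵗ⟩ a normal subgroup of Γ
-- inside Γ₀, contradicting faithfulness. A reflection gives the odd relator ρ₀σᵗρ₀σⁱρ₂, so
-- P is non-orientable; moreover q = 2t, and z = σᵗ acts on the neighbours of ρ₀Γ₀ as ρ₂.
-- The vertices σʲρ₀Γ₀ and ρ₀σᵏρ₀Γ₀ (j, k < t) are then 2t distinct vertices, except that
-- for even t the vertex ρ₀σ^(t/2)ρ₀Γ₀ may repeat one of the σʲρ₀Γ₀. In that case some vertex
-- lies outside the list, since otherwise z would act as σ² off the σʲρ₀Γ₀, hence fix
-- every vertex; it takes the place of ρ₀σ^(t/2)ρ₀Γ₀, and q ≤ v in all cases.

module Submission where

open import Defs
open import Level using (Level)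
open import Algebra.Bundles using (Group)
open import Data.Bool using (Bool; T; true; false)
open import Data.Empty using (⊥-elim)
open import Data.Fin as Fin using (Fin; zero; suc)
import Data.Fin.Properties as Fin
open import Data.List using (List; []; _∷_; _++_; _∷ʳ_; length; applyUpTo; lookup; reverse)
open import Data.List.Properties using (length-++; length-applyUpTo; unfold-reverse)
open import Data.List.Membership.Propositional.Properties using (∈-lookup)
open import Data.List.Relation.Unary.All as All using (All; []; _∷_)
import Data.List.Relation.Unary.All.Properties as All
open import Data.List.Relation.Unary.AllPairs as AllPairs using (AllPairs; []; _∷_)
import Data.List.Relation.Unary.AllPairs.Properties as AllPairsₚ
open import Data.Nat
  using (ℕ; zero; suc; pred; _+_; _*_; _∸_; _<_; _≤_; z≤n; s≤s; s≤s⁻¹; _<?_; _%_; _/_;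
         NonZero; >-nonZero)
open import Data.Nat.Properties
  using (_≟_; <-cmp; <-irrefl; <⇒≢; <⇒≤; <-trans; <-≤-trans; ≤-<-trans; ≮⇒≥; ≤-antisym;
         m<n⇒m<1+n; n<1+n; m<1+n⇒m<n∨m≡n; n≢0⇒n>0; m<m+n; m≤m+n; m<n⇒0<n∸m; m∸n≤m;
         ∸-monoʳ-<; m∸n+n≡m; m+[n∸m]≡n; +-comm; +-suc; +-identityʳ; +-mono-<; +-monoʳ-≤;
         *-comm; suc-injective; suc-pred; m+1+n≢0; even≢odd; anyUpTo?)
open import Data.Nat.Divisibility using (_∣_; divides; _∣0; ∣-refl; ∣m∣n⇒∣m+n; ∣⇒≤)
open import Data.Nat.DivMod using (m≡m%n+[m/n]*n; m%n<n)
open import Data.Nat.Induction using (<-rec)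
open import Data.Nat.Tactic.RingSolver using (solve-∀)
open import Data.Product using (∃; _×_; _,_; proj₁; proj₂)
open import Data.Sum using (_⊎_; inj₁; inj₂)
open import Function.Definitions using (Injective)
open import Relation.Binary.Core using (Rel)
open import Relation.Binary.Definitions using (tri<; tri≈; tri>)
import Relation.Binary.PropositionalEquality as ≡
open ≡ using (_≡_; _≢_)
open import Relation.Nullary using (¬_; Dec; yes; no)
import Relation.Nullary.Decidable as Dec
open import Relation.Nullary.Decidable using (_×-dec_; _⊎-dec_)
open import Relation.Unary using (Pred; Decidable)
open import Tactic.MonoidSolver using (solve)

module _ {p} {P : Pred ℕ p} where

  least-positive : Decidable P → ∀ n →
    (∀ {r} → 0 < r → r < n → ¬ P r) ⊎
    ∃ λ t → 0 < t × t < n × P t × (∀ {r} → 0 < r → r < t → ¬ P r)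
  least-positive P? zero = inj₁ (λ _ ())
  least-positive P? (suc n) with least-positive P? n
  ... | inj₂ (t , 0<t , t<n , Pt , below) = inj₂ (t , 0<t , m<n⇒m<1+n t<n , Pt , below)
  ... | inj₁ below with (0 <? n) ×-dec P? n
  ...   | yes (0<n , Pn) = inj₂ (n , 0<n , n<1+n n , Pn , below)
  ...   | no ¬0<n×Pn = inj₁ below′
    where
    below′ : ∀ {r} → 0 < r → r < suc n → ¬ P r
    below′ 0<r r<1+n Pr with m<1+n⇒m<n∨m≡n r<1+n
    ... | inj₁ r<n    = below 0<r r<n Pr
    ... | inj₂ ≡.refl = ¬0<n×Pn (0<r , Pr)

  least-positive-divides : ∀ {t} → 0 < t → (∀ {r} → 0 < r → r < t → ¬ P r) →
    (∀ {k} → t ≤ k → P k → P (k ∸ t)) → ∀ k → P k → t ∣ k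
  least-positive-divides {t} 0<t below closed = <-rec (λ k → P k → t ∣ k) go
    where
    go : ∀ k → (∀ {j} → j < k → P j → t ∣ j) → P k → t ∣ k
    go zero    _   _  = t ∣0
    go (suc k) rec Pk with suc k <? t
    ... | yes k<t = ⊥-elim (below (s≤s z≤n) k<t Pk)
    ... | no  k≮t = ≡.subst (t ∣_) (m∸n+n≡m t≤k) (∣m∣n⇒∣m+n (rec (∸-monoʳ-< 0<t t≤k) (closed t≤k Pk)) ∣-refl)
      where
      t≤k : t ≤ suc k
      t≤k = ≮⇒≥ k≮t

∣m+m⇒m+m≡n : ∀ {m n} → 0 < m → m < n → n ∣ m + m → m + m ≡ n
∣m+m⇒m+m≡n 0<m _ (divides zero eq) = ⊥-elim (<⇒≢ (<-≤-trans 0<m (m≤m+n _ _)) (≡.sym eq))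
∣m+m⇒m+m≡n {n = n} _ _ (divides (suc zero) eq) = ≡.trans eq (+-identityʳ n)
∣m+m⇒m+m≡n {m} {n} _ m<n (divides (suc (suc k)) eq) =
  ⊥-elim (<-irrefl eq (<-≤-trans (+-mono-< m<n m<n) (+-monoʳ-≤ n (m≤m+n n (k * n)))))

m+m-injective : ∀ {m n} → m + m ≡ n + n → m ≡ n
m+m-injective {m} {n} eq with <-cmp m n
... | tri< m<n _ _ = ⊥-elim (<⇒≢ (+-mono-< m<n m<n) eq)
... | tri≈ _ m≡n _ = m≡n
... | tri> _ _ n<m = ⊥-elim (<⇒≢ (+-mono-< n<m n<m) (≡.sym eq))

parity : ∀ n → (∃ λ s → s + s ≡ n) ⊎ (∀ k → k + k ≢ n)
parity zero = inj₁ (0 , ≡.refl)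
parity (suc zero) = inj₂ λ { zero () ; (suc k) e → m+1+n≢0 k (suc-injective e) }
parity (suc (suc n)) with parity n
... | inj₁ (s , e) = inj₁ (suc s , ≡.cong suc (≡.trans (+-suc s s) (≡.cong suc e)))
... | inj₂ odd     = inj₂ λ
  { zero () ; (suc k) e → odd k (suc-injective (≡.trans (≡.sym (+-suc k k)) (suc-injective e))) }

module _ {a} {A : Set a} where

  AllPairs-lookup : ∀ {r} {R : Rel A r} {xs} → AllPairs R xs →
    ∀ {i j : Fin (length xs)} → i Fin.< j → R (lookup xs i) (lookup xs j)
  AllPairs-lookup (px ∷ _)   {zero}  {suc j} _         = All.lookup px (∈-lookup j)
  AllPairs-lookup (_  ∷ pxs) {suc i} {suc j} (s≤s i<j) = AllPairs-lookup pxs i<j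

  distinct-classes⇒length≤ : ∀ {n} (cls : A → Fin n) {xs} →
    AllPairs (λ x y → cls x ≢ cls y) xs → length xs ≤ n
  distinct-classes⇒length≤ cls {xs} distinct = Fin.injective⇒≤ injective
    where
    injective : Injective _≡_ _≡_ (λ i → cls (lookup xs i))
    injective {i} {j} eq with Fin.<-cmp i j
    ... | tri< i<j _ _ = ⊥-elim (AllPairs-lookup distinct i<j eq)
    ... | tri≈ _ i≡j _ = i≡j
    ... | tri> _ _ j<i = ⊥-elim (AllPairs-lookup distinct j<i (≡.sym eq))

module GroupLemmas {c ℓ} (G : Group c ℓ) where
  open Group G
  open import Algebra.Properties.Group G
  open import Relation.Binary.Reasoning.Setoid setoid

  infixr 8 _^_
  _^_ : Carrier → ℕ → Carrier
  _^_ = pow G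

  ^-homo-+ : ∀ g m n → g ^ (m + n) ≈ g ^ m ∙ g ^ n
  ^-homo-+ g zero    n = sym (identityˡ _)
  ^-homo-+ g (suc m) n = trans (∙-congˡ (^-homo-+ g m n)) (sym (assoc _ _ _))

  ^-congˡ : ∀ {g h} n → g ≈ h → g ^ n ≈ h ^ n
  ^-congˡ zero    _   = refl
  ^-congˡ (suc n) g≈h = ∙-cong g≈h (^-congˡ n g≈h)

  ^-congʳ : ∀ g {m n} → m ≡ n → g ^ m ≈ g ^ n
  ^-congʳ g eq = reflexive (≡.cong (g ^_) eq)

  ε^n≈ε : ∀ n → ε ^ n ≈ ε
  ε^n≈ε zero    = refl
  ε^n≈ε (suc n) = trans (identityˡ _) (ε^n≈ε n)

  ^-* : ∀ g m n → g ^ (m * n) ≈ (g ^ n) ^ m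
  ^-* g zero    n = refl
  ^-* g (suc m) n = trans (^-homo-+ g n (m * n)) (∙-congˡ (^-* g m n))

  ^-commute : ∀ g n → g ^ n ∙ g ≈ g ∙ g ^ n
  ^-commute g zero    = trans (identityˡ _) (sym (identityʳ _))
  ^-commute g (suc n) = trans (assoc _ _ _) (∙-congˡ (^-commute g n))

  ^-comm : ∀ g m n → g ^ m ∙ g ^ n ≈ g ^ n ∙ g ^ m
  ^-comm g m n = begin
    g ^ m ∙ g ^ n  ≈⟨ sym (^-homo-+ g m n) ⟩
    g ^ (m + n)    ≈⟨ ^-congʳ g (+-comm m n) ⟩
    g ^ (n + m)    ≈⟨ ^-homo-+ g n m ⟩
    g ^ n ∙ g ^ m  ∎

  ⁻¹-^ : ∀ g n → (g ^ n) ⁻¹ ≈ (g ⁻¹) ^ n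
  ⁻¹-^ g zero    = ε⁻¹≈ε
  ⁻¹-^ g (suc n) = begin
    (g ∙ g ^ n) ⁻¹    ≈⟨ ⁻¹-anti-homo-∙ _ _ ⟩
    (g ^ n) ⁻¹ ∙ g ⁻¹ ≈⟨ ∙-congʳ (⁻¹-^ g n) ⟩
    (g ⁻¹) ^ n ∙ g ⁻¹   ≈⟨ ^-commute (g ⁻¹) n ⟩
    g ⁻¹ ∙ (g ⁻¹) ^ n   ∎

  conj : Carrier → Carrier → Carrier
  conj h g = h ⁻¹ ∙ (g ∙ h)

  conj-cong : ∀ h {g g′} → g ≈ g′ → conj h g ≈ conj h g′
  conj-cong h g≈g′ = ∙-congˡ (∙-congʳ g≈g′)

  conj-congˡ : ∀ {h h′} g → h ≈ h′ → conj h g ≈ conj h′ g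
  conj-congˡ g h≈h′ = ∙-cong (⁻¹-cong h≈h′) (∙-congˡ h≈h′)

  conj-homo-∙ : ∀ h g g′ → conj h (g ∙ g′) ≈ conj h g ∙ conj h g′
  conj-homo-∙ h g g′ = begin
    h ⁻¹ ∙ ((g ∙ g′) ∙ h)               ≈⟨ conj-cong h (∙-congʳ (sym (//-rightDividesʳ h g))) ⟩
    h ⁻¹ ∙ (((g ∙ h) ∙ h ⁻¹) ∙ g′ ∙ h)  ≈⟨ solve monoid ⟩
    (h ⁻¹ ∙ (g ∙ h)) ∙ (h ⁻¹ ∙ (g′ ∙ h)) ∎

  conj-ε : ∀ h → conj h ε ≈ ε
  conj-ε h = trans (∙-congˡ (identityˡ h)) (inverseˡ h)

  conj-by-ε : ∀ g → conj ε g ≈ g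
  conj-by-ε g = trans (∙-congʳ ε⁻¹≈ε) (trans (identityˡ _) (identityʳ _))

  conj-by-∙ : ∀ h h′ g → conj (h ∙ h′) g ≈ conj h′ (conj h g)
  conj-by-∙ h h′ g = begin
    (h ∙ h′) ⁻¹ ∙ (g ∙ (h ∙ h′))      ≈⟨ ∙-congʳ (⁻¹-anti-homo-∙ h h′) ⟩
    (h′ ⁻¹ ∙ h ⁻¹) ∙ (g ∙ (h ∙ h′))   ≈⟨ solve monoid ⟩
    h′ ⁻¹ ∙ ((h ⁻¹ ∙ (g ∙ h)) ∙ h′)   ∎

  conj-⁻¹ : ∀ h g → conj h (g ⁻¹) ≈ (conj h g) ⁻¹
  conj-⁻¹ h g = sym (begin
    (h ⁻¹ ∙ (g ∙ h)) ⁻¹          ≈⟨ ⁻¹-anti-homo-∙ _ _ ⟩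
    (g ∙ h) ⁻¹ ∙ h ⁻¹ ⁻¹         ≈⟨ ∙-cong (⁻¹-anti-homo-∙ _ _) (⁻¹-involutive h) ⟩
    (h ⁻¹ ∙ g ⁻¹) ∙ h            ≈⟨ assoc _ _ _ ⟩
    h ⁻¹ ∙ (g ⁻¹ ∙ h)            ∎)

  conj-^ : ∀ h g n → conj h (g ^ n) ≈ conj h g ^ n
  conj-^ h g zero    = conj-ε h
  conj-^ h g (suc n) = trans (conj-homo-∙ h g _) (∙-congˡ (conj-^ h g n))

  conj-\\ : ∀ h x y → conj h x ⁻¹ ∙ conj h y ≈ conj h (x ⁻¹ ∙ y)
  conj-\\ h x y = trans (∙-congʳ (sym (conj-⁻¹ h x))) (sym (conj-homo-∙ h (x ⁻¹) y))

  ∙ʳ-\\ : ∀ g x y → (x ∙ g) ⁻¹ ∙ (y ∙ g) ≈ conj g (x ⁻¹ ∙ y)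
  ∙ʳ-\\ g x y = begin
    (x ∙ g) ⁻¹ ∙ (y ∙ g)       ≈⟨ ∙-congʳ (⁻¹-anti-homo-∙ x g) ⟩
    (g ⁻¹ ∙ x ⁻¹) ∙ (y ∙ g)    ≈⟨ solve monoid ⟩
    g ⁻¹ ∙ ((x ⁻¹ ∙ y) ∙ g)    ∎

  conj-inverting-^ : ∀ {h g} → conj h g ≈ g ⁻¹ → ∀ n → conj h (g ^ n) ≈ (g ^ n) ⁻¹
  conj-inverting-^ {h} {g} inverts n = begin
    conj h (g ^ n)  ≈⟨ conj-^ h g n ⟩
    conj h g ^ n    ≈⟨ ^-congˡ n inverts ⟩
    (g ⁻¹) ^ n      ≈⟨ sym (⁻¹-^ g n) ⟩
    (g ^ n) ⁻¹      ∎

module StringCGroup {c ℓ} (G : Group c ℓ) (ρ : Fin 3 → Group.Carrier G)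
                    (R : IsRegularPolyhedronGroup G ρ) where
  open Group G
  open import Algebra.Properties.Group G
  open import Relation.Binary.Reasoning.Setoid setoid
  open GroupLemmas G
  open Words G ρ
  open IsRegularPolyhedronGroup R

  ρ₀ ρ₁ ρ₂ σ : Carrier
  ρ₀ = ρ zero
  ρ₁ = ρ (suc zero)
  ρ₂ = ρ (suc (suc zero))
  σ  = ρ₁ ∙ ρ₂

  ρ-involutive : ∀ i → ρ i ∙ ρ i ≈ ε
  ρ-involutive i with involutions i
  ... | _ , ρ²≈ε , _ = trans (∙-congˡ (sym (identityʳ _))) ρ²≈ε

  ρ⁻¹≈ρ : ∀ i → ρ i ⁻¹ ≈ ρ i
  ρ⁻¹≈ρ i = sym (inverseˡ-unique _ _ (ρ-involutive i))

  ρ≉ε : ∀ i → ¬ ρ i ≈ ε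
  ρ≉ε i ρ≈ε with involutions i
  ... | _ , _ , minimal = minimal 1 (s≤s z≤n) (s≤s (s≤s z≤n)) (trans (identityʳ _) ρ≈ε)

  ρ∙≈conj∙ρ : ∀ i x → ρ i ∙ x ≈ conj (ρ i) x ∙ ρ i
  ρ∙≈conj∙ρ i x = begin
    ρ i ∙ x                          ≈⟨ sym (//-rightDividesʳ (ρ i) _) ⟩
    (ρ i ∙ x) ∙ ρ i ∙ ρ i ⁻¹         ≈⟨ ∙-congˡ (ρ⁻¹≈ρ i) ⟩
    (ρ i ∙ x) ∙ ρ i ∙ ρ i            ≈⟨ ∙-congʳ (trans (assoc _ _ _) (∙-congʳ (sym (ρ⁻¹≈ρ i)))) ⟩
    conj (ρ i) x ∙ ρ i               ∎

  conj-ρ-involutive : ∀ i x → conj (ρ i) (conj (ρ i) x) ≈ x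
  conj-ρ-involutive i x = begin
    conj (ρ i) (conj (ρ i) x)  ≈⟨ sym (conj-by-∙ (ρ i) (ρ i) x) ⟩
    conj (ρ i ∙ ρ i) x         ≈⟨ conj-congˡ x (ρ-involutive i) ⟩
    conj ε x                   ≈⟨ conj-by-ε x ⟩
    x                          ∎

  ∙ρ-involutive : ∀ i x → x ∙ ρ i ∙ ρ i ≈ x
  ∙ρ-involutive i x = trans (assoc _ _ _) (trans (∙-congˡ (ρ-involutive i)) (identityʳ x))

  conj-ρ₀-ρ₂ : conj ρ₀ ρ₂ ≈ ρ₂
  conj-ρ₀-ρ₂ = begin
    ρ₀ ⁻¹ ∙ (ρ₂ ∙ ρ₀)   ≈⟨ ∙-congʳ (ρ⁻¹≈ρ zero) ⟩
    ρ₀ ∙ (ρ₂ ∙ ρ₀)      ≈⟨ inverseˡ-unique _ ρ₂ (trans commuted string) ⟩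
    ρ₂ ⁻¹               ≈⟨ ρ⁻¹≈ρ _ ⟩
    ρ₂                  ∎
    where
    commuted : ρ₀ ∙ (ρ₂ ∙ ρ₀) ∙ ρ₂ ≈ (ρ₀ ∙ ρ₂) ∙ (ρ₀ ∙ ρ₂)
    commuted = solve monoid

  eval-++ : ∀ w w′ → eval (w ++ w′) ≈ eval w ∙ eval w′
  eval-++ []      w′ = sym (identityˡ _)
  eval-++ (i ∷ w) w′ = trans (∙-congˡ (eval-++ w w′)) (sym (assoc _ _ _))

  eval-reverse : ∀ w → eval (reverse w) ≈ eval w ⁻¹
  eval-reverse []      = sym ε⁻¹≈ε
  eval-reverse (i ∷ w) = begin
    eval (reverse (i ∷ w))        ≈⟨ reflexive (≡.cong eval (unfold-reverse i w)) ⟩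
    eval (reverse w ∷ʳ i)         ≈⟨ eval-++ (reverse w) (i ∷ []) ⟩
    eval (reverse w) ∙ (ρ i ∙ ε)  ≈⟨ ∙-cong (eval-reverse w) (trans (identityʳ _) (sym (ρ⁻¹≈ρ i))) ⟩
    eval w ⁻¹ ∙ ρ i ⁻¹            ≈⟨ sym (⁻¹-anti-homo-∙ _ _) ⟩
    (ρ i ∙ eval w) ⁻¹             ∎

  module _ {I : Fin 3 → Bool} where

    All-reverse : ∀ {w} → All (λ i → T (I i)) w → All (λ i → T (I i)) (reverse w)
    All-reverse []                 = []
    All-reverse {i ∷ w} (Ii ∷ Iw) =
      ≡.subst (All _) (≡.sym (unfold-reverse i w)) (All.∷ʳ⁺ (All-reverse Iw) Ii)

    InGen-resp : ∀ {g h} → g ≈ h → InGen I g → InGen I h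
    InGen-resp g≈h (w , Iw , w≈g) = w , Iw , trans w≈g g≈h

    InGen-ε : InGen I ε
    InGen-ε = [] , [] , refl

    InGen-ρ : ∀ i → T (I i) → InGen I (ρ i)
    InGen-ρ i Ii = i ∷ [] , Ii ∷ [] , identityʳ _

    InGen-∙ : ∀ {g h} → InGen I g → InGen I h → InGen I (g ∙ h)
    InGen-∙ (w , Iw , w≈g) (w′ , Iw′ , w′≈h) =
      w ++ w′ , All.++⁺ Iw Iw′ , trans (eval-++ w w′) (∙-cong w≈g w′≈h)

    InGen-⁻¹ : ∀ {g} → InGen I g → InGen I (g ⁻¹)
    InGen-⁻¹ (w , Iw , w≈g) = reverse w , All-reverse Iw , trans (eval-reverse w) (⁻¹-cong w≈g)

    InGen-^ : ∀ {g} n → InGen I g → InGen I (g ^ n)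
    InGen-^ zero    _  = InGen-ε
    InGen-^ (suc n) Ig = InGen-∙ Ig (InGen-^ n Ig)

  Γ₀ : Carrier → Set ℓ
  Γ₀ = InGen (i12 G)

  ρ₁∈Γ₀ : Γ₀ ρ₁
  ρ₁∈Γ₀ = InGen-ρ (suc zero) _

  ρ₂∈Γ₀ : Γ₀ ρ₂
  ρ₂∈Γ₀ = InGen-ρ (suc (suc zero)) _

  σ^∈Γ₀ : ∀ n → Γ₀ (σ ^ n)
  σ^∈Γ₀ n = InGen-^ n (InGen-∙ ρ₁∈Γ₀ ρ₂∈Γ₀)

  only-ρ₀ : Fin 3 → Bool
  only-ρ₀ zero    = true
  only-ρ₀ (suc _) = false

  ρ₀∉Γ₀ : ¬ Γ₀ ρ₀
  ρ₀∉Γ₀ ρ₀∈Γ₀ with intersection only-ρ₀ (i12 G) ρ₀ (InGen-ρ zero _) ρ₀∈Γ₀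
  ... | []        , []     , ε≈ρ₀ = ρ≉ε zero (sym ε≈ρ₀)
  ... | zero  ∷ _ , () ∷ _ , _
  ... | suc _ ∷ _ , () ∷ _ , _

  infix 4 _~_
  _~_ : Carrier → Carrier → Set ℓ
  _~_ = SameVertex G ρ

  ≈⇒~ : ∀ {g h} → g ≈ h → g ~ h
  ≈⇒~ {g} g≈h = InGen-resp (trans (sym (inverseˡ g)) (∙-congˡ g≈h)) InGen-ε

  ~-sym : ∀ {g h} → g ~ h → h ~ g
  ~-sym {g} {h} g~h = InGen-resp (begin
    (g ⁻¹ ∙ h) ⁻¹      ≈⟨ ⁻¹-anti-homo-∙ _ _ ⟩
    h ⁻¹ ∙ g ⁻¹ ⁻¹     ≈⟨ ∙-congˡ (⁻¹-involutive g) ⟩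
    h ⁻¹ ∙ g           ∎) (InGen-⁻¹ g~h)

  ~-trans : ∀ {g h k} → g ~ h → h ~ k → g ~ k
  ~-trans {g} {h} {k} g~h h~k = InGen-resp (begin
    (g ⁻¹ ∙ h) ∙ (h ⁻¹ ∙ k)  ≈⟨ assoc _ _ _ ⟩
    g ⁻¹ ∙ (h ∙ (h ⁻¹ ∙ k))  ≈⟨ ∙-congˡ (\\-leftDividesˡ h k) ⟩
    g ⁻¹ ∙ k                 ∎) (InGen-∙ g~h h~k)

  translate-invariant : ∀ g h h′ → (g ∙ h) ⁻¹ ∙ (g ∙ h′) ≈ h ⁻¹ ∙ h′
  translate-invariant g h h′ = begin
    (g ∙ h) ⁻¹ ∙ (g ∙ h′)       ≈⟨ ∙-congʳ (⁻¹-anti-homo-∙ g h) ⟩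
    (h ⁻¹ ∙ g ⁻¹) ∙ (g ∙ h′)    ≈⟨ assoc _ _ _ ⟩
    h ⁻¹ ∙ (g ⁻¹ ∙ (g ∙ h′))    ≈⟨ ∙-congˡ (\\-leftDividesʳ g h′) ⟩
    h ⁻¹ ∙ h′                   ∎

  translate : ∀ g {h h′} → h ~ h′ → g ∙ h ~ g ∙ h′
  translate g {h} {h′} = InGen-resp (sym (translate-invariant g h h′))

  translate⁻¹ : ∀ g {h h′} → g ∙ h ~ g ∙ h′ → h ~ h′
  translate⁻¹ g {h} {h′} = InGen-resp (translate-invariant g h h′)

  ε~⇒Γ₀ : ∀ {g} → ε ~ g → Γ₀ g
  ε~⇒Γ₀ = InGen-resp (trans (∙-congʳ ε⁻¹≈ε) (identityˡ _))

  σ⁻¹≈ρ₂ρ₁ : σ ⁻¹ ≈ ρ₂ ∙ ρ₁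
  σ⁻¹≈ρ₂ρ₁ = trans (⁻¹-anti-homo-∙ ρ₁ ρ₂) (∙-cong (ρ⁻¹≈ρ _) (ρ⁻¹≈ρ _))

  conj-ρ₁-σ : conj ρ₁ σ ≈ σ ⁻¹
  conj-ρ₁-σ = begin
    ρ₁ ⁻¹ ∙ ((ρ₁ ∙ ρ₂) ∙ ρ₁)  ≈⟨ ∙-congˡ (assoc _ _ _) ⟩
    ρ₁ ⁻¹ ∙ (ρ₁ ∙ (ρ₂ ∙ ρ₁))  ≈⟨ \\-leftDividesʳ ρ₁ _ ⟩
    ρ₂ ∙ ρ₁                   ≈⟨ sym σ⁻¹≈ρ₂ρ₁ ⟩
    σ ⁻¹                      ∎

  conj-ρ₂-σ : conj ρ₂ σ ≈ σ ⁻¹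
  conj-ρ₂-σ = begin
    ρ₂ ⁻¹ ∙ ((ρ₁ ∙ ρ₂) ∙ ρ₂)  ≈⟨ ∙-cong (ρ⁻¹≈ρ _) (trans (assoc _ _ _) (∙-congˡ (ρ-involutive _))) ⟩
    ρ₂ ∙ (ρ₁ ∙ ε)             ≈⟨ ∙-congˡ (identityʳ ρ₁) ⟩
    ρ₂ ∙ ρ₁                   ≈⟨ sym σ⁻¹≈ρ₂ρ₁ ⟩
    σ ⁻¹                      ∎

  conj-ρ₁-σ^ : ∀ n → conj ρ₁ (σ ^ n) ≈ (σ ^ n) ⁻¹
  conj-ρ₁-σ^ = conj-inverting-^ conj-ρ₁-σ

  conj-ρ₂-σ^ : ∀ n → conj ρ₂ (σ ^ n) ≈ (σ ^ n) ⁻¹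
  conj-ρ₂-σ^ = conj-inverting-^ conj-ρ₂-σ

  σ^ρ₂-involutive : ∀ n → (σ ^ n ∙ ρ₂) ∙ (σ ^ n ∙ ρ₂) ≈ ε
  σ^ρ₂-involutive n = begin
    (σ ^ n ∙ ρ₂) ∙ (σ ^ n ∙ ρ₂)    ≈⟨ solve monoid ⟩
    σ ^ n ∙ (ρ₂ ∙ (σ ^ n ∙ ρ₂))    ≈⟨ ∙-congˡ (∙-congʳ (sym (ρ⁻¹≈ρ _))) ⟩
    σ ^ n ∙ conj ρ₂ (σ ^ n)        ≈⟨ ∙-congˡ (conj-ρ₂-σ^ n) ⟩
    σ ^ n ∙ (σ ^ n) ⁻¹             ≈⟨ inverseʳ _ ⟩
    ε                              ∎

  σ^ρ₂σ^≈ρ₂ : ∀ n → σ ^ n ∙ (ρ₂ ∙ σ ^ n) ≈ ρ₂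
  σ^ρ₂σ^≈ρ₂ n = begin
    σ ^ n ∙ (ρ₂ ∙ σ ^ n)  ≈⟨ inverseˡ-unique _ ρ₂ (trans regroup (σ^ρ₂-involutive n)) ⟩
    ρ₂ ⁻¹                 ≈⟨ ρ⁻¹≈ρ _ ⟩
    ρ₂                    ∎
    where
    regroup : σ ^ n ∙ (ρ₂ ∙ σ ^ n) ∙ ρ₂ ≈ (σ ^ n ∙ ρ₂) ∙ (σ ^ n ∙ ρ₂)
    regroup = solve monoid

  σ-word : ℕ → List (Fin 3)
  σ-word zero    = []
  σ-word (suc n) = suc zero ∷ suc (suc zero) ∷ σ-word n

  eval-σ-word-++ : ∀ n w → eval (σ-word n ++ w) ≈ σ ^ n ∙ eval w
  eval-σ-word-++ zero    w = sym (identityˡ _)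
  eval-σ-word-++ (suc n) w = begin
    ρ₁ ∙ (ρ₂ ∙ eval (σ-word n ++ w))  ≈⟨ ∙-congˡ (∙-congˡ (eval-σ-word-++ n w)) ⟩
    ρ₁ ∙ (ρ₂ ∙ (σ ^ n ∙ eval w))      ≈⟨ solve monoid ⟩
    (σ ∙ σ ^ n) ∙ eval w              ∎

  length-σ-word : ∀ n → length (σ-word n) ≡ n + n
  length-σ-word zero    = ≡.refl
  length-σ-word (suc n) = ≡.cong suc (≡.trans (≡.cong suc (length-σ-word n)) (≡.sym (+-suc n n)))

  reflection⇒non-orientable : ∀ {t i} → conj ρ₀ (σ ^ t) ≈ σ ^ i ∙ ρ₂ → ¬ Orientable G ρ
  reflection⇒non-orientable {t} {i} reflection orientable = odd-length (orientable word eval-word≈ε)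
    where
    word : List (Fin 3)
    word = zero ∷ σ-word t ++ zero ∷ σ-word i ++ suc (suc zero) ∷ []

    eval-word≈ε : eval word ≈ ε
    eval-word≈ε = begin
      ρ₀ ∙ eval (σ-word t ++ zero ∷ σ-word i ++ suc (suc zero) ∷ [])
        ≈⟨ ∙-congˡ (trans (eval-σ-word-++ t _) (∙-congˡ (∙-congˡ (eval-σ-word-++ i _)))) ⟩
      ρ₀ ∙ (σ ^ t ∙ (ρ₀ ∙ (σ ^ i ∙ (ρ₂ ∙ ε))))   ≈⟨ solve monoid ⟩
      (ρ₀ ∙ (σ ^ t ∙ ρ₀)) ∙ (σ ^ i ∙ ρ₂)         ≈⟨ ∙-congʳ (∙-congʳ (sym (ρ⁻¹≈ρ zero))) ⟩
      conj ρ₀ (σ ^ t) ∙ (σ ^ i ∙ ρ₂)             ≈⟨ ∙-congʳ reflection ⟩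
      (σ ^ i ∙ ρ₂) ∙ (σ ^ i ∙ ρ₂)                ≈⟨ σ^ρ₂-involutive i ⟩
      ε                                          ∎

    length-word : length word ≡ suc (2 * (t + i + 1))
    length-word = ≡.cong suc (≡.trans (length-++ (σ-word t)) (≡.trans
      (≡.cong₂ (λ m n → m + suc n) (length-σ-word t)
               (≡.trans (length-++ (σ-word i)) (≡.cong (_+ 1) (length-σ-word i))))
      (arithmetic t i)))
      where
      arithmetic : ∀ t i → t + t + suc (i + i + 1) ≡ 2 * (t + i + 1)
      arithmetic = solve-∀

    odd-length : ¬ 2 ∣ length word
    odd-length (divides k length≡k*2) =
      even≢odd k (t + i + 1) (≡.trans (*-comm 2 k) (≡.trans (≡.sym length≡k*2) length-word))

  ~-respʳ : ∀ {g h h′} → h ≈ h′ → g ~ h → g ~ h′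
  ~-respʳ h≈h′ g~h = ~-trans g~h (≈⇒~ h≈h′)

  ~-respˡ : ∀ {g g′ h} → g ≈ g′ → g ~ h → g′ ~ h
  ~-respˡ g≈g′ g~h = ~-trans (≈⇒~ (sym g≈g′)) g~h

  -- For j < q the vertices nb j are the neighbours of the base vertex Γ₀,
  -- and the nb′ k those of its neighbour ρ₀Γ₀.
  nb nb′ : ℕ → Carrier
  nb  j = σ ^ j ∙ ρ₀
  nb′ k = conj ρ₀ (σ ^ k)

  Stabilises : ℕ → Set ℓ
  Stabilises k = ρ₀ ~ nb k

  StabFree : ℕ → Set ℓ
  StabFree n = ∀ {r} → 0 < r → r < n → ¬ Stabilises r

  nb′-+ : ∀ m n → nb′ (m + n) ≈ nb′ m ∙ nb′ n
  nb′-+ m n = trans (conj-cong ρ₀ (^-homo-+ σ m n)) (conj-homo-∙ ρ₀ _ _)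

  nb′-∸ : ∀ {j k} → j ≤ k → nb′ k ≈ nb′ j ∙ nb′ (k ∸ j)
  nb′-∸ {j} {k} j≤k = trans (reflexive (≡.cong nb′ (≡.sym (m+[n∸m]≡n j≤k)))) (nb′-+ j (k ∸ j))

  Stabilises-∸ : ∀ {j k} → j ≤ k → Stabilises k → Stabilises j → Stabilises (k ∸ j)
  Stabilises-∸ j≤k stab-k stab-j =
    InGen-resp (trans (∙-congˡ (nb′-∸ j≤k)) (\\-leftDividesʳ _ _)) (InGen-∙ (InGen-⁻¹ stab-j) stab-k)

  nb~nb⇒Stabilises : ∀ {j k} → j ≤ k → nb j ~ nb k → Stabilises (k ∸ j)
  nb~nb⇒Stabilises {j} {k} j≤k nbj~nbk = translate⁻¹ (σ ^ j) (~-respʳ split nbj~nbk)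
    where
    split : nb k ≈ σ ^ j ∙ nb (k ∸ j)
    split = begin
      σ ^ k ∙ ρ₀                   ≈⟨ ∙-congʳ (^-congʳ σ (≡.sym (m+[n∸m]≡n j≤k))) ⟩
      σ ^ (j + (k ∸ j)) ∙ ρ₀       ≈⟨ ∙-congʳ (^-homo-+ σ j (k ∸ j)) ⟩
      σ ^ j ∙ σ ^ (k ∸ j) ∙ ρ₀     ≈⟨ assoc _ _ _ ⟩
      σ ^ j ∙ nb (k ∸ j)           ∎

  nb′~nb′⇒Stabilises : ∀ {j k} → j ≤ k → nb′ j ~ nb′ k → Stabilises (k ∸ j)
  nb′~nb′⇒Stabilises {j} j≤k nb′j~nb′k =
    ε~⇒Γ₀ (translate⁻¹ (nb′ j) (~-respˡ (sym (identityʳ _)) (~-respʳ (nb′-∸ j≤k) nb′j~nb′k)))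

  StabFree⇒injective : ∀ {n} → StabFree n → (f : ℕ → Carrier) →
    (∀ {j k} → j ≤ k → f j ~ f k → Stabilises (k ∸ j)) →
    ∀ {j k} → j < n → k < n → f j ~ f k → j ≡ k
  StabFree⇒injective free f stab {j} {k} j<n k<n fj~fk with <-cmp j k
  ... | tri< j<k _ _ = ⊥-elim (free (m<n⇒0<n∸m j<k) (≤-<-trans (m∸n≤m k j) k<n) (stab (<⇒≤ j<k) fj~fk))
  ... | tri≈ _ j≡k _ = j≡k
  ... | tri> _ _ k<j = ⊥-elim (free (m<n⇒0<n∸m k<j) (≤-<-trans (m∸n≤m j k) j<n) (stab (<⇒≤ k<j) (~-sym fj~fk)))

  ε≁nb : ∀ j → ¬ ε ~ nb j
  ε≁nb j ε~nb = ρ₀∉Γ₀ (InGen-resp (\\-leftDividesʳ (σ ^ j) ρ₀) (InGen-∙ (InGen-⁻¹ (σ^∈Γ₀ j)) (ε~⇒Γ₀ ε~nb)))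

  -- ⟨x⟩ is normal in Γ and lies in the vertex stabiliser Γ₀, so x fixes every vertex.
  normal-in-Γ₀⇒ε : VertexFaithful G ρ → ∀ {x} → Γ₀ x →
    (∀ i → ∃ λ j → conj (ρ i) x ≈ x ^ j) → x ≈ ε
  normal-in-Γ₀⇒ε faithful {x} x∈Γ₀ normal = faithful x fixes
    where
    conj-word : ∀ w → ∃ λ k → conj (eval w) x ≈ x ^ k
    conj-word []      = 1 , trans (conj-by-ε x) (sym (identityʳ x))
    conj-word (i ∷ w) with normal i | conj-word w
    ... | j , conj-ρ≈ | k , conj-w≈ = j * k , (begin
      conj (ρ i ∙ eval w) x         ≈⟨ conj-by-∙ (ρ i) (eval w) x ⟩
      conj (eval w) (conj (ρ i) x)  ≈⟨ conj-cong (eval w) conj-ρ≈ ⟩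
      conj (eval w) (x ^ j)         ≈⟨ conj-^ (eval w) x j ⟩
      conj (eval w) x ^ j           ≈⟨ ^-congˡ j conj-w≈ ⟩
      (x ^ k) ^ j                   ≈⟨ sym (^-* x j k) ⟩
      x ^ (j * k)                   ∎)

    fixes : ∀ h → x ∙ h ~ h
    fixes h with generates h
    ... | w , _ , w≈h with conj-word w
    ... | k , conj≈ = ~-sym (InGen-resp (trans (sym conj≈) (conj-congˡ x w≈h)) (InGen-^ k x∈Γ₀))

  module Vertices {v} (vertices : HasVertices G ρ v) where

    rep : Fin v → Carrier
    rep = proj₁ vertices

    idx : Carrier → Fin v
    idx g = proj₁ (proj₂ (proj₂ vertices) g)

    rep-idx : ∀ g → rep (idx g) ~ g
    rep-idx g = proj₂ (proj₂ (proj₂ vertices) g)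

    idx≡⇒~ : ∀ {g h} → idx g ≡ idx h → g ~ h
    idx≡⇒~ {g} {h} eq = ~-trans (~-sym (rep-idx g)) (≡.subst (λ i → rep i ~ h) (≡.sym eq) (rep-idx h))

    ~⇒idx≡ : ∀ {g h} → g ~ h → idx g ≡ idx h
    ~⇒idx≡ {g} {h} g~h = proj₁ (proj₂ vertices) _ _ (~-trans (rep-idx g) (~-trans g~h (~-sym (rep-idx h))))

    _~?_ : ∀ g h → Dec (g ~ h)
    g ~? h = Dec.map′ idx≡⇒~ ~⇒idx≡ (idx g Fin.≟ idx h)

    Stabilises? : Decidable Stabilises
    Stabilises? k = ρ₀ ~? nb k

    distinct⇒length≤ : ∀ {gs} → AllPairs (λ g h → ¬ g ~ h) gs → length gs ≤ v
    distinct⇒length≤ distinct =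
      distinct-classes⇒length≤ idx (AllPairs.map (λ g≁h eq → g≁h (idx≡⇒~ eq)) distinct)

    StabFree⇒<v : ∀ {n} → StabFree n → n < v
    StabFree⇒<v {n} free = ≡.subst (_≤ v) (≡.cong suc (length-applyUpTo nb n)) (distinct⇒length≤ distinct)
      where
      distinct : AllPairs (λ g h → ¬ g ~ h) (ε ∷ applyUpTo nb n)
      distinct = All.applyUpTo⁺₁ nb n (λ {j} _ → ε≁nb j)
               ∷ AllPairsₚ.applyUpTo⁺₁ nb n (λ i<j j<n nbi~nbj →
                   <⇒≢ i<j (StabFree⇒injective free nb nb~nb⇒Stabilises (<-trans i<j j<n) j<n nbi~nbj))

  module Order {q} (σ-order : HasOrder G σ q) where

    0<q : 0 < q
    0<q = proj₁ σ-order

    σ^q≈ε : σ ^ q ≈ ε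
    σ^q≈ε = proj₁ (proj₂ σ-order)

    σ^-minimal : ∀ k → 0 < k → k < q → ¬ σ ^ k ≈ ε
    σ^-minimal = proj₂ (proj₂ σ-order)

    instance
      q-nonZero : NonZero q
      q-nonZero = >-nonZero 0<q

    σ^[k*q]≈ε : ∀ k → σ ^ (k * q) ≈ ε
    σ^[k*q]≈ε k = trans (^-* σ k q) (trans (^-congˡ k σ^q≈ε) (ε^n≈ε k))

    σ^≈ε⇒q∣ : ∀ k → σ ^ k ≈ ε → q ∣ k
    σ^≈ε⇒q∣ = least-positive-divides 0<q (σ^-minimal _) closed
      where
      closed : ∀ {k} → q ≤ k → σ ^ k ≈ ε → σ ^ (k ∸ q) ≈ ε
      closed {k} q≤k σ^k≈ε = begin
        σ ^ (k ∸ q)              ≈⟨ sym (identityʳ _) ⟩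
        σ ^ (k ∸ q) ∙ ε          ≈⟨ ∙-congˡ (sym σ^q≈ε) ⟩
        σ ^ (k ∸ q) ∙ σ ^ q      ≈⟨ sym (^-homo-+ σ (k ∸ q) q) ⟩
        σ ^ (k ∸ q + q)          ≈⟨ ^-congʳ σ (m∸n+n≡m q≤k) ⟩
        σ ^ k                    ≈⟨ σ^k≈ε ⟩
        ε                        ∎

    σ^-mod : ∀ n → σ ^ n ≈ σ ^ (n % q)
    σ^-mod n = begin
      σ ^ n                                ≈⟨ ^-congʳ σ (m≡m%n+[m/n]*n n q) ⟩
      σ ^ (n % q + (n / q) * q)            ≈⟨ ^-homo-+ σ (n % q) _ ⟩
      σ ^ (n % q) ∙ σ ^ ((n / q) * q)      ≈⟨ ∙-congˡ (σ^[k*q]≈ε (n / q)) ⟩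
      σ ^ (n % q) ∙ ε                      ≈⟨ identityʳ _ ⟩
      σ ^ (n % q)                          ∎

    σ^⁻¹ : ∀ k → (σ ^ k) ⁻¹ ≈ σ ^ (k * pred q)
    σ^⁻¹ k = begin
      (σ ^ k) ⁻¹           ≈⟨ ⁻¹-^ σ k ⟩
      (σ ⁻¹) ^ k           ≈⟨ ^-congˡ k σ⁻¹≈σ^[q-1] ⟩
      (σ ^ pred q) ^ k     ≈⟨ sym (^-* σ k (pred q)) ⟩
      σ ^ (k * pred q)     ∎
      where
      σ⁻¹≈σ^[q-1] : σ ⁻¹ ≈ σ ^ pred q
      σ⁻¹≈σ^[q-1] = sym (inverseʳ-unique σ _ (trans (^-congʳ σ (suc-pred q)) σ^q≈ε))

    ρ₂∙σ^ : ∀ k → ρ₂ ∙ σ ^ k ≈ σ ^ (k * pred q) ∙ ρ₂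
    ρ₂∙σ^ k = begin
      ρ₂ ∙ σ ^ k                   ≈⟨ ρ∙≈conj∙ρ (suc (suc zero)) _ ⟩
      conj ρ₂ (σ ^ k) ∙ ρ₂         ≈⟨ ∙-congʳ (trans (conj-ρ₂-σ^ k) (σ^⁻¹ k)) ⟩
      σ ^ (k * pred q) ∙ ρ₂        ∎

    ρ₁∙σ^ : ∀ k → ρ₁ ∙ σ ^ k ≈ σ ^ suc (k * pred q) ∙ ρ₂
    ρ₁∙σ^ k = begin
      ρ₁ ∙ σ ^ k                   ≈⟨ ∙-congʳ (sym (∙ρ-involutive (suc (suc zero)) ρ₁)) ⟩
      σ ∙ ρ₂ ∙ σ ^ k               ≈⟨ assoc _ _ _ ⟩
      σ ∙ (ρ₂ ∙ σ ^ k)             ≈⟨ ∙-congˡ (ρ₂∙σ^ k) ⟩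
      σ ∙ (σ ^ (k * pred q) ∙ ρ₂)  ≈⟨ sym (assoc _ _ _) ⟩
      σ ^ suc (k * pred q) ∙ ρ₂    ∎

    ρ∙σ^ : ∀ {i} → T (i12 G i) → ∀ k → ∃ λ e → ρ i ∙ σ ^ k ≈ σ ^ e ∙ ρ₂
    ρ∙σ^ {suc zero}       _ k = suc (k * pred q) , ρ₁∙σ^ k
    ρ∙σ^ {suc (suc zero)} _ k = k * pred q , ρ₂∙σ^ k

    word-normal-form : ∀ w → All (λ i → T (i12 G i)) w →
      ∃ λ e → eval w ≈ σ ^ e ⊎ eval w ≈ σ ^ e ∙ ρ₂
    word-normal-form []      []          = 0 , inj₁ refl
    word-normal-form (i ∷ w) (i∈ ∷ w∈) with word-normal-form w w∈
    ... | e , inj₁ w≈σ^e = let e′ , swap = ρ∙σ^ i∈ e in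
      e′ , inj₂ (trans (∙-congˡ w≈σ^e) swap)
    ... | e , inj₂ w≈σ^eρ₂ = let e′ , swap = ρ∙σ^ i∈ e in
      e′ , inj₁ (begin
        ρ i ∙ eval w             ≈⟨ ∙-congˡ w≈σ^eρ₂ ⟩
        ρ i ∙ (σ ^ e ∙ ρ₂)       ≈⟨ sym (assoc _ _ _) ⟩
        ρ i ∙ σ ^ e ∙ ρ₂         ≈⟨ ∙-congʳ swap ⟩
        σ ^ e′ ∙ ρ₂ ∙ ρ₂         ≈⟨ ∙ρ-involutive _ _ ⟩
        σ ^ e′                   ∎)

    Γ₀-normal-form : ∀ {g} → Γ₀ g → ∃ λ i → i < q × (g ≈ σ ^ i ⊎ g ≈ σ ^ i ∙ ρ₂)
    Γ₀-normal-form (w , w∈ , w≈g) with word-normal-form w w∈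
    ... | e , inj₁ w≈ = e % q , m%n<n e q , inj₁ (trans (sym w≈g) (trans w≈ (σ^-mod e)))
    ... | e , inj₂ w≈ = e % q , m%n<n e q , inj₂ (trans (sym w≈g) (trans w≈ (∙-congʳ (σ^-mod e))))

    σ^≈ρ₂-impossible : ∀ {t} → 0 < t → t < q → ¬ σ ^ t ≈ ρ₂
    σ^≈ρ₂-impossible {t} 0<t t<q σ^t≈ρ₂ = ρ≉ε (suc zero) (begin
      ρ₁                ≈⟨ sym (∙ρ-involutive (suc (suc zero)) ρ₁) ⟩
      σ ∙ ρ₂            ≈⟨ ∙-congʳ (trans (sym (identityʳ σ)) (trans (^-congʳ σ (≡.sym t≡1)) σ^t≈ρ₂)) ⟩
      ρ₂ ∙ ρ₂           ≈⟨ ρ-involutive _ ⟩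
      ε                 ∎)
      where
      σ≈σ⁻¹ : σ ≈ σ ⁻¹
      σ≈σ⁻¹ = begin
        σ                          ≈⟨ sym (\\-leftDividesʳ (σ ^ t) σ) ⟩
        (σ ^ t) ⁻¹ ∙ (σ ^ t ∙ σ)   ≈⟨ ∙-congˡ (^-commute σ t) ⟩
        conj (σ ^ t) σ             ≈⟨ conj-congˡ σ σ^t≈ρ₂ ⟩
        conj ρ₂ σ                  ≈⟨ conj-ρ₂-σ ⟩
        σ ⁻¹                       ∎

      q≤2 : q ≤ 2
      q≤2 = ∣⇒≤ (σ^≈ε⇒q∣ 2 (trans (∙-congˡ (identityʳ σ)) (trans (∙-congˡ σ≈σ⁻¹) (inverseʳ σ))))

      t≡1 : t ≡ 1
      t≡1 = ≤-antisym (s≤s⁻¹ (<-≤-trans t<q q≤2)) 0<t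

    rotation-impossible : VertexFaithful G ρ → ∀ {t i} → 0 < t → t < q → StabFree t →
      ¬ nb′ t ≈ σ ^ i
    rotation-impossible faithful {t} {i} 0<t t<q free rotation =
      σ^-minimal t 0<t t<q (normal-in-Γ₀⇒ε faithful (σ^∈Γ₀ t) normal)
      where
      stab-t : Stabilises t
      stab-t = InGen-resp (sym rotation) (σ^∈Γ₀ i)

      stab-i : Stabilises i
      stab-i = InGen-resp (trans (sym (conj-ρ-involutive zero (σ ^ t))) (conj-cong ρ₀ rotation)) (σ^∈Γ₀ t)

      inverse-as-power : (σ ^ t) ⁻¹ ≈ (σ ^ t) ^ pred q
      inverse-as-power = trans (σ^⁻¹ t) (trans (^-congʳ σ (*-comm t (pred q))) (^-* σ (pred q) t))

      normal : ∀ j → ∃ λ e → conj (ρ j) (σ ^ t) ≈ (σ ^ t) ^ e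
      normal zero with least-positive-divides 0<t free (λ t≤k stab-k → Stabilises-∸ t≤k stab-k stab-t) i stab-i
      ... | divides e i≡e*t = e , trans rotation (trans (^-congʳ σ i≡e*t) (^-* σ e t))
      normal (suc zero)       = pred q , trans (conj-ρ₁-σ^ t) inverse-as-power
      normal (suc (suc zero)) = pred q , trans (conj-ρ₂-σ^ t) inverse-as-power

    reflection⇒half-turn : ∀ {t i} → 0 < t → t < q → i < q → nb′ t ≈ σ ^ i ∙ ρ₂ →
      t + t ≡ q × nb′ t ≈ σ ^ t ∙ ρ₂
    reflection⇒half-turn {t} {i} 0<t t<q i<q reflection = t+t≡q , ≡.subst (λ k → nb′ t ≈ σ ^ k ∙ ρ₂) i≡t reflection
      where
      conj-ρ₀-σ^tρ₂ : conj ρ₀ (σ ^ t ∙ ρ₂) ≈ σ ^ i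
      conj-ρ₀-σ^tρ₂ = begin
        conj ρ₀ (σ ^ t ∙ ρ₂)             ≈⟨ conj-homo-∙ ρ₀ _ _ ⟩
        nb′ t ∙ conj ρ₀ ρ₂               ≈⟨ ∙-cong reflection conj-ρ₀-ρ₂ ⟩
        σ ^ i ∙ ρ₂ ∙ ρ₂                  ≈⟨ ∙ρ-involutive _ _ ⟩
        σ ^ i                            ∎

      σ^[t+t]≈ε : σ ^ (t + t) ≈ ε
      σ^[t+t]≈ε = begin
        σ ^ (t + t)                          ≈⟨ sym (conj-ρ-involutive zero _) ⟩
        conj ρ₀ (nb′ (t + t))                ≈⟨ conj-cong ρ₀ (trans (nb′-+ t t) (∙-cong reflection reflection)) ⟩
        conj ρ₀ ((σ ^ i ∙ ρ₂) ∙ (σ ^ i ∙ ρ₂)) ≈⟨ conj-cong ρ₀ (σ^ρ₂-involutive i) ⟩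
        conj ρ₀ ε                            ≈⟨ conj-ε ρ₀ ⟩
        ε                                    ∎

      σ^[i+i]≈ε : σ ^ (i + i) ≈ ε
      σ^[i+i]≈ε = begin
        σ ^ (i + i)                                   ≈⟨ ^-homo-+ σ i i ⟩
        σ ^ i ∙ σ ^ i                                 ≈⟨ sym (∙-cong conj-ρ₀-σ^tρ₂ conj-ρ₀-σ^tρ₂) ⟩
        conj ρ₀ (σ ^ t ∙ ρ₂) ∙ conj ρ₀ (σ ^ t ∙ ρ₂)   ≈⟨ sym (conj-homo-∙ ρ₀ _ _) ⟩
        conj ρ₀ ((σ ^ t ∙ ρ₂) ∙ (σ ^ t ∙ ρ₂))         ≈⟨ conj-cong ρ₀ (σ^ρ₂-involutive t) ⟩
        conj ρ₀ ε                                     ≈⟨ conj-ε ρ₀ ⟩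
        ε                                             ∎

      t+t≡q : t + t ≡ q
      t+t≡q = ∣m+m⇒m+m≡n 0<t t<q (σ^≈ε⇒q∣ _ σ^[t+t]≈ε)

      i≢0 : i ≢ 0
      i≢0 ≡.refl = σ^≈ρ₂-impossible 0<t t<q (begin
        σ ^ t                ≈⟨ inverseˡ-unique _ ρ₂ σ^tρ₂≈ε ⟩
        ρ₂ ⁻¹                ≈⟨ ρ⁻¹≈ρ _ ⟩
        ρ₂                   ∎)
        where
        σ^tρ₂≈ε : σ ^ t ∙ ρ₂ ≈ ε
        σ^tρ₂≈ε = trans (sym (conj-ρ-involutive zero _)) (trans (conj-cong ρ₀ conj-ρ₀-σ^tρ₂) (conj-ε ρ₀))

      i≡t : i ≡ t
      i≡t = m+m-injective (≡.trans (∣m+m⇒m+m≡n (n≢0⇒n>0 i≢0) i<q (σ^≈ε⇒q∣ _ σ^[i+i]≈ε)) (≡.sym t+t≡q))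

    module HalfTurn {t} (0<t : 0 < t) (t+t≡q : t + t ≡ q) (free : StabFree t)
                    (turn : nb′ t ≈ σ ^ t ∙ ρ₂) where

      z : Carrier
      z = σ ^ t

      t<q : t < q
      t<q = ≡.subst (t <_) t+t≡q (m<m+n t 0<t)

      z-involutive : z ∙ z ≈ ε
      z-involutive = trans (sym (^-homo-+ σ t t)) (trans (^-congʳ σ t+t≡q) σ^q≈ε)

      conj-σ^-z : ∀ k → conj (σ ^ k) z ≈ z
      conj-σ^-z k = trans (∙-congˡ (^-comm σ t k)) (\\-leftDividesʳ _ _)

      conj-ρ₀-zρ₂ : conj ρ₀ (z ∙ ρ₂) ≈ z
      conj-ρ₀-zρ₂ = trans (conj-homo-∙ ρ₀ z ρ₂) (trans (∙-cong turn conj-ρ₀-ρ₂) (∙ρ-involutive _ z))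

      conj-nb-z : ∀ j → conj (nb j) z ≈ z ∙ ρ₂
      conj-nb-z j = begin
        conj (σ ^ j ∙ ρ₀) z        ≈⟨ conj-by-∙ (σ ^ j) ρ₀ z ⟩
        conj ρ₀ (conj (σ ^ j) z)   ≈⟨ conj-cong ρ₀ (conj-σ^-z j) ⟩
        nb′ t                      ≈⟨ turn ⟩
        z ∙ ρ₂                     ∎

      z∙ρ₂∈Γ₀ : Γ₀ (z ∙ ρ₂)
      z∙ρ₂∈Γ₀ = InGen-∙ (σ^∈Γ₀ t) ρ₂∈Γ₀

      z-fixes-nb : ∀ j → nb j ~ z ∙ nb j
      z-fixes-nb j = InGen-resp (sym (conj-nb-z j)) z∙ρ₂∈Γ₀

      z-swaps-nb′ : ∀ {k} → k ≤ t → nb′ (t ∸ k) ~ z ∙ nb′ k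
      z-swaps-nb′ {k} k≤t = InGen-resp (sym swap) ρ₂∈Γ₀
        where
        σ^[t-k]⁻¹∙z≈σ^k : (σ ^ (t ∸ k)) ⁻¹ ∙ z ≈ σ ^ k
        σ^[t-k]⁻¹∙z≈σ^k = begin
          (σ ^ (t ∸ k)) ⁻¹ ∙ z                    ≈⟨ ∙-congˡ (^-congʳ σ (≡.sym (m∸n+n≡m k≤t))) ⟩
          (σ ^ (t ∸ k)) ⁻¹ ∙ σ ^ (t ∸ k + k)      ≈⟨ ∙-congˡ (^-homo-+ σ (t ∸ k) k) ⟩
          (σ ^ (t ∸ k)) ⁻¹ ∙ (σ ^ (t ∸ k) ∙ σ ^ k) ≈⟨ \\-leftDividesʳ _ _ ⟩
          σ ^ k                                   ∎

        swap : nb′ (t ∸ k) ⁻¹ ∙ (z ∙ nb′ k) ≈ ρ₂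
        swap = begin
          nb′ (t ∸ k) ⁻¹ ∙ (z ∙ nb′ k)                    ≈⟨ ∙-congˡ (∙-congʳ (sym conj-ρ₀-zρ₂)) ⟩
          nb′ (t ∸ k) ⁻¹ ∙ (conj ρ₀ (z ∙ ρ₂) ∙ nb′ k)     ≈⟨ ∙-congˡ (sym (conj-homo-∙ ρ₀ _ _)) ⟩
          nb′ (t ∸ k) ⁻¹ ∙ conj ρ₀ (z ∙ ρ₂ ∙ σ ^ k)       ≈⟨ conj-\\ ρ₀ _ _ ⟩
          conj ρ₀ ((σ ^ (t ∸ k)) ⁻¹ ∙ (z ∙ ρ₂ ∙ σ ^ k))    ≈⟨ conj-cong ρ₀ regroup ⟩
          conj ρ₀ ((σ ^ (t ∸ k)) ⁻¹ ∙ z ∙ (ρ₂ ∙ σ ^ k))   ≈⟨ conj-cong ρ₀ (∙-congʳ σ^[t-k]⁻¹∙z≈σ^k) ⟩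
          conj ρ₀ (σ ^ k ∙ (ρ₂ ∙ σ ^ k))                  ≈⟨ conj-cong ρ₀ (σ^ρ₂σ^≈ρ₂ k) ⟩
          conj ρ₀ ρ₂                                      ≈⟨ conj-ρ₀-ρ₂ ⟩
          ρ₂                                              ∎
          where
          regroup : (σ ^ (t ∸ k)) ⁻¹ ∙ (z ∙ ρ₂ ∙ σ ^ k) ≈ (σ ^ (t ∸ k)) ⁻¹ ∙ z ∙ (ρ₂ ∙ σ ^ k)
          regroup = solve monoid

      z-acts-as-ρ₂-on-nb′ : ∀ k → z ∙ nb′ k ~ ρ₂ ∙ nb′ k
      z-acts-as-ρ₂-on-nb′ k = InGen-resp (sym (trans (∙ʳ-\\ (nb′ k) z ρ₂) conj≈)) z∙ρ₂∈Γ₀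
        where
        conj≈ : conj (nb′ k) (z ⁻¹ ∙ ρ₂) ≈ z ∙ ρ₂
        conj≈ = begin
          conj (ρ₀ ⁻¹ ∙ nb k) (z ⁻¹ ∙ ρ₂)          ≈⟨ conj-by-∙ (ρ₀ ⁻¹) (nb k) _ ⟩
          conj (nb k) (conj (ρ₀ ⁻¹) (z ⁻¹ ∙ ρ₂))   ≈⟨ conj-cong (nb k) (conj-congˡ _ (ρ⁻¹≈ρ zero)) ⟩
          conj (nb k) (conj ρ₀ (z ⁻¹ ∙ ρ₂))        ≈⟨ conj-cong (nb k) (conj-cong ρ₀ (∙-congʳ z⁻¹≈z)) ⟩
          conj (nb k) (conj ρ₀ (z ∙ ρ₂))           ≈⟨ conj-cong (nb k) conj-ρ₀-zρ₂ ⟩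
          conj (nb k) z                            ≈⟨ conj-nb-z k ⟩
          z ∙ ρ₂                                   ∎
          where
          z⁻¹≈z : z ⁻¹ ≈ z
          z⁻¹≈z = sym (inverseˡ-unique z z z-involutive)

      nb′-injective : ∀ {j k} → j < t → k < t → nb′ j ~ nb′ k → j ≡ k
      nb′-injective = StabFree⇒injective free nb′ nb′~nb′⇒Stabilises

      nb-injective : ∀ {j k} → j < t → k < t → nb j ~ nb k → j ≡ k
      nb-injective = StabFree⇒injective free nb nb~nb⇒Stabilises

      nb′~nb⇒half : ∀ {k j} → k < t → nb′ k ~ nb j → k + k ≡ t
      nb′~nb⇒half {zero} {j} _ nb′0~nb = ⊥-elim (ε≁nb j (~-respˡ (conj-ε ρ₀) nb′0~nb))
      nb′~nb⇒half {k@(suc _)} {j} k<t nb′k~nb = ≡.trans (≡.cong (k +_) (≡.sym t-k≡k)) (m+[n∸m]≡n (<⇒≤ k<t))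
        where
        nb′[t-k]~nb′k : nb′ (t ∸ k) ~ nb′ k
        nb′[t-k]~nb′k = ~-trans (z-swaps-nb′ (<⇒≤ k<t))
          (~-trans (translate z nb′k~nb) (~-trans (~-sym (z-fixes-nb j)) (~-sym nb′k~nb)))

        t-k≡k : t ∸ k ≡ k
        t-k≡k = nb′-injective (∸-monoʳ-< (s≤s z≤n) (<⇒≤ k<t)) k<t nb′[t-k]~nb′k

      σ∙nb-closed : ∀ {j} → j < t → ∃ λ j′ → j′ < t × σ ∙ nb j′ ~ nb j
      σ∙nb-closed {suc j} j<t = j , <-trans (n<1+n j) j<t , ≈⇒~ (sym (assoc _ _ _))
      σ∙nb-closed {zero}  _   = pred t , pred<t , ~-trans (≈⇒~ σ∙nb[t-1]≈z∙nb0) (~-sym (z-fixes-nb 0))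
        where
        instance
          t-nonZero : NonZero t
          t-nonZero = >-nonZero 0<t

        pred<t : pred t < t
        pred<t = ≡.subst (pred t <_) (suc-pred t) (n<1+n (pred t))

        σ∙nb[t-1]≈z∙nb0 : σ ∙ nb (pred t) ≈ z ∙ nb 0
        σ∙nb[t-1]≈z∙nb0 = begin
          σ ∙ (σ ^ pred t ∙ ρ₀)   ≈⟨ sym (assoc _ _ _) ⟩
          σ ^ suc (pred t) ∙ ρ₀   ≈⟨ ∙-congʳ (^-congʳ σ (suc-pred t)) ⟩
          z ∙ ρ₀                  ≈⟨ ∙-congˡ (sym (identityˡ ρ₀)) ⟩
          z ∙ nb 0                ∎

      OffNb : Carrier → Set ℓ
      OffNb h = ∀ {j} → j < t → ¬ h ~ nb j

      OffNb-resp : ∀ {g h} → g ~ h → OffNb g → OffNb h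
      OffNb-resp g~h off j<t h~nb = off j<t (~-trans g~h h~nb)

      OffNb-σ : ∀ {h} → OffNb h → OffNb (σ ∙ h)
      OffNb-σ off j<t σh~nb with σ∙nb-closed j<t
      ... | j′ , j′<t , σnb~nb = off j′<t (translate⁻¹ σ (~-trans σh~nb (~-sym σnb~nb)))

      OffNb-σ^ : ∀ n {h} → OffNb h → OffNb (σ ^ n ∙ h)
      OffNb-σ^ zero    off = OffNb-resp (≈⇒~ (sym (identityˡ _))) off
      OffNb-σ^ (suc n) off = OffNb-resp (≈⇒~ (sym (assoc _ _ _))) (OffNb-σ (OffNb-σ^ n off))

      module Bound {v} (vertices : HasVertices G ρ v) (faithful : VertexFaithful G ρ) where
        open Vertices vertices

        Listed : Carrier → Set ℓ
        Listed h = (∃ λ j → j < t × h ~ nb j) ⊎ (∃ λ k → k < t × h ~ nb′ k)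

        Listed? : ∀ h → Dec (Listed h)
        Listed? h = anyUpTo? (λ j → h ~? nb j) t ⊎-dec anyUpTo? (λ k → h ~? nb′ k) t

        Listed-resp : ∀ {g h} → g ~ h → Listed g → Listed h
        Listed-resp g~h (inj₁ (j , j<t , g~nb)) = inj₁ (j , j<t , ~-trans (~-sym g~h) g~nb)
        Listed-resp g~h (inj₂ (k , k<t , g~nb′)) = inj₂ (k , k<t , ~-trans (~-sym g~h) g~nb′)

        -- nb′ k with the vertex nb′ (t/2), which may coincide with some nb j, replaced by y
        nb″ : Carrier → ℕ → Carrier
        nb″ y k with k + k ≟ t
        ... | yes _ = y
        ... | no  _ = nb′ k

        nb″-view : ∀ y k → (k + k ≡ t × nb″ y k ≡ y) ⊎ (k + k ≢ t × nb″ y k ≡ nb′ k)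
        nb″-view y k with k + k ≟ t
        ... | yes k+k≡t = inj₁ (k+k≡t , ≡.refl)
        ... | no  k+k≢t = inj₂ (k+k≢t , ≡.refl)

        t+t≤v-using : (y : Carrier) → ((∃ λ s → s + s ≡ t) → ¬ Listed y) → t + t ≤ v
        t+t≤v-using y y-unlisted = ≡.subst (_≤ v) length≡ (distinct⇒length≤ distinct)
          where
          length≡ : length (applyUpTo nb t ++ applyUpTo (nb″ y) t) ≡ t + t
          length≡ = ≡.trans (length-++ (applyUpTo nb t))
                            (≡.cong₂ _+_ (length-applyUpTo nb t) (length-applyUpTo (nb″ y) t))

          nb-distinct : ∀ {i j} → i < j → j < t → ¬ nb i ~ nb j
          nb-distinct i<j j<t nbi~nbj = <⇒≢ i<j (nb-injective (<-trans i<j j<t) j<t nbi~nbj)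

          nb″-distinct : ∀ {i j} → i < j → j < t → ¬ nb″ y i ~ nb″ y j
          nb″-distinct {i} {j} i<j j<t e with nb″-view y i | nb″-view y j
          ... | inj₁ (i+i≡t , ≡i) | inj₁ (j+j≡t , ≡j) = <⇒≢ i<j (m+m-injective (≡.trans i+i≡t (≡.sym j+j≡t)))
          ... | inj₁ (i+i≡t , ≡i) | inj₂ (_ , ≡j) =
            y-unlisted (i , i+i≡t) (inj₂ (j , j<t , ≡.subst₂ _~_ ≡i ≡j e))
          ... | inj₂ (_ , ≡i) | inj₁ (j+j≡t , ≡j) =
            y-unlisted (j , j+j≡t) (inj₂ (i , <-trans i<j j<t , ~-sym (≡.subst₂ _~_ ≡i ≡j e)))
          ... | inj₂ (_ , ≡i) | inj₂ (_ , ≡j) =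
            <⇒≢ i<j (nb′-injective (<-trans i<j j<t) j<t (≡.subst₂ _~_ ≡i ≡j e))

          nb≁nb″ : ∀ {j k} → j < t → k < t → ¬ nb j ~ nb″ y k
          nb≁nb″ {j} {k} j<t k<t e with nb″-view y k
          ... | inj₁ (k+k≡t , ≡k) = y-unlisted (k , k+k≡t) (inj₁ (j , j<t , ~-sym (≡.subst (nb j ~_) ≡k e)))
          ... | inj₂ (k+k≢t , ≡k) = k+k≢t (nb′~nb⇒half {j = j} k<t (~-sym (≡.subst (nb j ~_) ≡k e)))

          distinct : AllPairs (λ g h → ¬ g ~ h) (applyUpTo nb t ++ applyUpTo (nb″ y) t)
          distinct = AllPairsₚ.++⁺ (AllPairsₚ.applyUpTo⁺₁ nb t nb-distinct)
                                  (AllPairsₚ.applyUpTo⁺₁ (nb″ y) t nb″-distinct)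
                                  (All.applyUpTo⁺₁ nb t λ j<t → All.applyUpTo⁺₁ (nb″ y) t (nb≁nb″ j<t))

        even-impossible : (∃ λ s → s + s ≡ t) → ¬ (∀ h → Listed h)
        even-impossible (s , s+s≡t) all-listed = σ^-minimal t 0<t t<q (faithful z z-fixes-all)
          where
          ρ₂-acts-as-z : ∀ {h} → OffNb h → ρ₂ ∙ h ~ z ∙ h
          ρ₂-acts-as-z {h} off with all-listed h
          ... | inj₁ (j , j<t , h~nb)  = ⊥-elim (off j<t h~nb)
          ... | inj₂ (k , _   , h~nb′) = ~-trans (translate ρ₂ h~nb′)
            (~-trans (~-sym (z-acts-as-ρ₂-on-nb′ k)) (translate z (~-sym h~nb′)))

          σ-twice : ∀ {h} → OffNb h → h ~ σ ∙ (σ ∙ h)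
          σ-twice {h} off = ~-respˡ (\\-leftDividesˡ σ h) (translate σ σ⁻¹h~σh)
            where
            reflected : ρ₂ ∙ (σ ∙ (ρ₂ ∙ h)) ≈ σ ⁻¹ ∙ h
            reflected = begin
              ρ₂ ∙ (σ ∙ (ρ₂ ∙ h))    ≈⟨ solve monoid ⟩
              ρ₂ ∙ (σ ∙ ρ₂) ∙ h      ≈⟨ ∙-congʳ (∙-congʳ (sym (ρ⁻¹≈ρ _))) ⟩
              conj ρ₂ σ ∙ h          ≈⟨ ∙-congʳ conj-ρ₂-σ ⟩
              σ ⁻¹ ∙ h               ∎

            commute : ρ₂ ∙ (σ ∙ (z ∙ h)) ≈ ρ₂ ∙ (z ∙ (σ ∙ h))
            commute = ∙-congˡ (begin
              σ ∙ (z ∙ h)   ≈⟨ sym (assoc _ _ _) ⟩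
              σ ∙ z ∙ h     ≈⟨ ∙-congʳ (sym (^-commute σ t)) ⟩
              z ∙ σ ∙ h     ≈⟨ assoc _ _ _ ⟩
              z ∙ (σ ∙ h)   ∎)

            cancel : z ∙ (z ∙ (σ ∙ h)) ≈ σ ∙ h
            cancel = trans (sym (assoc _ _ _)) (trans (∙-congʳ z-involutive) (identityˡ _))

            σ⁻¹h~σh : σ ⁻¹ ∙ h ~ σ ∙ h
            σ⁻¹h~σh = ~-respˡ reflected (~-trans
              (~-respʳ commute (translate ρ₂ (translate σ (ρ₂-acts-as-z off))))
              (~-respʳ cancel (ρ₂-acts-as-z (OffNb-σ^ t (OffNb-σ off)))))

          iterate : ∀ n {h} → OffNb h → h ~ σ ^ (n + n) ∙ h
          iterate zero            off = ≈⇒~ (sym (identityˡ _))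
          iterate (suc n) {h} off = ~-trans (iterate n off) (~-respʳ regroup (σ-twice (OffNb-σ^ (n + n) off)))
            where
            regroup : σ ∙ (σ ∙ (σ ^ (n + n) ∙ h)) ≈ σ ^ (suc n + suc n) ∙ h
            regroup = begin
              σ ∙ (σ ∙ (σ ^ (n + n) ∙ h))  ≈⟨ sym (trans (assoc _ _ _) (∙-congˡ (assoc _ _ _))) ⟩
              σ ^ suc (suc (n + n)) ∙ h    ≈⟨ ∙-congʳ (^-congʳ σ (≡.cong suc (≡.sym (+-suc n n)))) ⟩
              σ ^ (suc n + suc n) ∙ h      ∎

          z-fixes-all : ∀ h → z ∙ h ~ h
          z-fixes-all h with anyUpTo? (λ j → h ~? nb j) t
          ... | yes (j , j<t , h~nb) = ~-trans (translate z h~nb) (~-trans (~-sym (z-fixes-nb j)) (~-sym h~nb))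
          ... | no  off = ~-sym (~-respʳ (∙-congʳ (^-congʳ σ s+s≡t)) (iterate s λ j<t h~nb → off (_ , j<t , h~nb)))

        q≤v : q ≤ v
        q≤v = ≡.subst (_≤ v) t+t≡q t+t≤v
          where
          t+t≤v : t + t ≤ v
          t+t≤v with parity t
          ... | inj₂ odd  = t+t≤v-using ε (λ (s , s+s≡t) → ⊥-elim (odd s s+s≡t))
          ... | inj₁ even with Fin.all? (λ i → Listed? (rep i))
          ...   | yes all-reps = ⊥-elim (even-impossible even λ h → Listed-resp (rep-idx h) (all-reps (idx h)))
          ...   | no ¬all-reps =
            let i , unlisted = Fin.¬∀⟶∃¬ v _ (λ i → Listed? (rep i)) ¬all-reps
            in t+t≤v-using (rep i) (λ _ → unlisted)

proposition3p1 : ∀ {c ℓ : Level} (G : Group c ℓ) (ρ : Fin 3 → Group.Carrier G)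
    → IsRegularPolyhedronGroup G ρ
    → (p q v : ℕ) → HasType G ρ p q → HasVertices G ρ v → VertexFaithful G ρ
    → (Orientable G ρ → q < v) × (¬ Orientable G ρ → q ≤ v)
proposition3p1 G ρ R p q v (_ , σ-order) vertices faithful = cases
  where
  open StringCGroup G ρ R
  open Vertices vertices
  open Order σ-order

  cases : (Orientable G ρ → q < v) × (¬ Orientable G ρ → q ≤ v)
  cases with least-positive Stabilises? q
  ... | inj₁ free = (λ _ → StabFree⇒<v free) , (λ _ → <⇒≤ (StabFree⇒<v free))
  ... | inj₂ (t , 0<t , t<q , stab-t , free) with Γ₀-normal-form stab-t
  ...   | i , _   , inj₁ rotation   = ⊥-elim (rotation-impossible faithful {t} {i} 0<t t<q free rotation)
  ...   | i , i<q , inj₂ reflection =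
    let t+t≡q , turn = reflection⇒half-turn {t} {i} 0<t t<q i<q reflection in
    (λ orientable → ⊥-elim (reflection⇒non-orientable {t} {i} reflection orientable)) ,
    (λ _ → HalfTurn.Bound.q≤v 0<t t+t≡q free turn vertices faithful)
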